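{- Let $r$ and $n$ be integers with $r \geq n \geq 3$, and let $(E,G)$ be a $\mathrm{PG}(n-1,2)$-free rank-$r$ binary representation of the simple binary matroid $M = G|E$. If $H$ is a hyperplane of $G$ such that $(E \cap H, G|H)$ is not $\mathrm{PG}(n-2,2)$-free, then $|E \setminus H| \leq \left(1-\frac{1}{2^{n-1}}\right)2^{r-1}$. Furthermore, if in addition $|E| > \left(1-\frac{3}{2^n}\right)2^r$, then $|E \cap H| > \left(1-\frac{2}{2^{n-1}}\right)2^{r-1}$.
   Context: A rank-$r$ binary representation is an ordered pair $(E,G)$ where $G \cong \mathrm{PG}(r-1,2)$ (the ambient geometry) and $E$ is a subset of the points of $G$; it represents the simple binary matroid $G|E$ (whose rank may be less than $r$). A matroid is $N$-free if it has no restriction isomorphic to $N$, and $(E,G)$ is called $N$-free when $G|E$ is $N$-free. For a hyperplane $H$ of $G$, $(E\cap H, G|H)$ is the binary representation with ambient geometry $G|H \cong \mathrm{PG}(r-2,2)$ and ground set $E \cap H$. -}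

module Defs where

open import Data.Bool using (Bool; true; false; _∧_; _∨_; _xor_; not; if_then_else_)
open import Data.Nat using (ℕ; zero; suc; _+_)
open import Data.List using (List; []; _∷_; _++_; map; foldr)
open import Data.Vec using (Vec; []; _∷_; replicate; zipWith)
open import Data.Product using (Σ; _×_; _,_)
open import Function.Bundles using (_⇔_)
open import Relation.Nullary using (¬_)
open import Relation.Binary.PropositionalEquality using (_≡_; _≢_)

-- Vectors of F_2^r, with F_2 = Bool (xor = addition, ∧ = multiplication).
𝔽₂^ : ℕ → Set
𝔽₂^ r = Vec Bool r

allVecs : (r : ℕ) → List (𝔽₂^ r)
allVecs zero = [] ∷ []
allVecs (suc r) = map (false ∷_) (allVecs r) ++ map (true ∷_) (allVecs r)

zeroV : (r : ℕ) → 𝔽₂^ r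
zeroV r = replicate r false

_⊕_ : ∀ {r} → 𝔽₂^ r → 𝔽₂^ r → 𝔽₂^ r
_⊕_ = zipWith _xor_

-- a vector is nonzero (i.e. is a point of PG(r-1,2))
isNz : ∀ {r} → 𝔽₂^ r → Bool
isNz [] = false
isNz (b ∷ v) = b ∨ isNz v

_==v_ : ∀ {r} → 𝔽₂^ r → 𝔽₂^ r → Bool
[] ==v [] = true
(a ∷ u) ==v (b ∷ v) = not (a xor b) ∧ (u ==v v)

dot : ∀ {r} → 𝔽₂^ r → 𝔽₂^ r → Bool
dot [] [] = false
dot (a ∷ u) (b ∷ v) = (a ∧ b) xor dot u v

VSet : ℕ → Set
VSet r = 𝔽₂^ r → Bool

_⊆_ : ∀ {r} → VSet r → VSet r → Set
S ⊆ T = ∀ x → S x ≡ true → T x ≡ true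

vsum : (r : ℕ) → VSet r → 𝔽₂^ r
vsum r S = foldr (λ x acc → if S x then x ⊕ acc else acc) (zeroV r) (allVecs r)

count : (r : ℕ) → VSet r → ℕ
count r S = foldr (λ x acc → if S x then suc acc else acc) 0 (allVecs r)

_∩_ : ∀ {r} → VSet r → VSet r → VSet r
(S ∩ T) x = S x ∧ T x

_∖_ : ∀ {r} → VSet r → VSet r → VSet r
(S ∖ T) x = S x ∧ not (T x)

-- The set of points of PG(r-1,2): all nonzero vectors.
Points : (r : ℕ) → VSet r
Points r = isNz

-- Linear independence over GF(2) of a set of vectors:
-- no nonempty subset sums to zero.
Indep : (r : ℕ) → VSet r → Set
Indep r X = ∀ (T : VSet r) → T ⊆ X → Σ (𝔽₂^ r) (λ x → T x ≡ true) → vsum r T ≢ zeroV r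

image : ∀ {k r} → (𝔽₂^ k → 𝔽₂^ r) → VSet k → VSet r
image {k} f S y = foldr (λ x acc → (S x ∧ (f x ==v y)) ∨ acc) false (allVecs k)

-- The simple binary matroid G|E (G = PG(r-1,2), E ⊆ points) has a restriction
-- isomorphic to PG(k-1,2): there is an injection f from the points of PG(k-1,2)
-- into E such that a set S of points of PG(k-1,2) is independent iff f[S] is
-- independent in G|E.
HasPGRestriction : (k r : ℕ) → VSet r → Set
HasPGRestriction k r E =
  Σ (𝔽₂^ k → 𝔽₂^ r) λ f →
    (∀ x → isNz x ≡ true → E (f x) ≡ true)
    × (∀ x y → isNz x ≡ true → isNz y ≡ true → f x ≡ f y → x ≡ y)
    × (∀ (S : VSet k) → S ⊆ Points k → (Indep k S ⇔ Indep r (image f S)))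

PGFree : (k r : ℕ) → VSet r → Set
PGFree k r E = ¬ HasPGRestriction k r E

-- A binary representation (E, G) of rank r, G = PG(r-1,2): E is a set of points.
IsRep : (r : ℕ) → VSet r → Set
IsRep r E = E ⊆ Points r

-- The hyperplane of PG(r-1,2) determined by a nonzero functional a:
-- the points x with a·x = 0.
hyperplane : (r : ℕ) → 𝔽₂^ r → VSet r
hyperplane r a x = isNz x ∧ not (dot a x)

-- A PG(n-2,2)-restriction of E ∩ H spans an (n-1)-dimensional subspace W ⊆ H whose nonzero
-- vectors all lie in E. For x ∉ H the coset x + W cannot lie inside E, since W ∪ (x + W) would be a
-- PG(n-1,2)-restriction. Summing |E ∩ (x + W)| over the 2^(r-1) points x off H counts every point
-- of E ∖ H exactly 2^(n-1) times, while each coset contributes at most 2^(n-1) - 1; hence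
-- 2^(n-1) |E ∖ H| ≤ (2^(n-1) - 1) 2^(r-1). The second bound follows from |E| = |E ∩ H| + |E ∖ H|.

module Submission where

open import Defs
open import Algebra.Definitions using (Associative; Commutative; LeftIdentity; RightIdentity)
open import Data.Bool using (Bool; true; false; _∧_; _∨_; _xor_; not; if_then_else_)
open import Data.Bool.Properties
  using (∨-assoc; ∨-comm; ∨-identityˡ; ∨-zeroʳ; ∧-zeroʳ; ∧-identityʳ; ∧-conicalˡ; ∧-conicalʳ; not-involutive;
         xor-assoc; xor-comm; xor-identityˡ; xor-identityʳ; xor-same; ∧-distribˡ-xor;
         xor-∧-commutativeRing)
open import Data.List using (List; []; _∷_; _++_; map; foldr)
open import Data.List.Properties using (foldr-cong)
open import Data.Nat using (ℕ; zero; suc; _+_; _*_; _∸_; _^_; _≤_; _<_; z≤n; s≤s; _≤?_)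
open import Data.Nat.Properties
open import Data.Nat.Solver using (module +-*-Solver)
open import Data.Product using (Σ; ∃; _×_; _,_)
open import Data.Sum using (_⊎_; inj₁; inj₂)
open import Data.Vec using ([]; _∷_)
open import Data.Vec.Properties using (zipWith-assoc; zipWith-comm; zipWith-identityˡ; zipWith-identityʳ)
open import Function using (_∘_)
open import Function.Bundles using (_⇔_; mk⇔; Equivalence)
open import Function.Definitions using (Injective)
open import Data.Empty using (⊥; ⊥-elim)
open import Relation.Nullary using (¬_; yes; no; Dec; contradiction)
open import Relation.Nullary.Decidable using (decidable-stable)
open import Relation.Binary.PropositionalEquality
open import Algebra.Bundles using (CommutativeRing)
open import Algebra.Properties.CommutativeSemigroup
  (CommutativeRing.+-commutativeSemigroup xor-∧-commutativeRing)
  using () renaming (interchange to xor-interchange)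

⊕-assoc : ∀ {r} → Associative _≡_ (_⊕_ {r})
⊕-assoc = zipWith-assoc xor-assoc

⊕-comm : ∀ {r} → Commutative _≡_ (_⊕_ {r})
⊕-comm = zipWith-comm xor-comm

⊕-identityˡ : ∀ {r} → LeftIdentity _≡_ (zeroV r) _⊕_
⊕-identityˡ = zipWith-identityˡ xor-identityˡ

⊕-identityʳ : ∀ {r} → RightIdentity _≡_ (zeroV r) _⊕_
⊕-identityʳ = zipWith-identityʳ xor-identityʳ

⊕-self : ∀ {r} (x : 𝔽₂^ r) → x ⊕ x ≡ zeroV r
⊕-self [] = refl
⊕-self (b ∷ x) = cong₂ _∷_ (xor-same b) (⊕-self x)

⊕-cancelˡ : ∀ {r} (c x y : 𝔽₂^ r) → c ⊕ x ≡ c ⊕ y → x ≡ y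
⊕-cancelˡ {r} c x y e = begin
  x                ≡⟨ ⊕-identityˡ x ⟨
  zeroV r ⊕ x      ≡⟨ cong (_⊕ x) (⊕-self c) ⟨
  (c ⊕ c) ⊕ x      ≡⟨ ⊕-assoc c c x ⟩
  c ⊕ (c ⊕ x)      ≡⟨ cong (c ⊕_) e ⟩
  c ⊕ (c ⊕ y)      ≡⟨ ⊕-assoc c c y ⟨
  (c ⊕ c) ⊕ y      ≡⟨ cong (_⊕ y) (⊕-self c) ⟩
  zeroV r ⊕ y      ≡⟨ ⊕-identityˡ y ⟩
  y                ∎
  where open ≡-Reasoning

⊕≡zeroV⇒≡ : ∀ {r} (x y : 𝔽₂^ r) → x ⊕ y ≡ zeroV r → x ≡ y
⊕≡zeroV⇒≡ x y e = sym (⊕-cancelˡ x y x (trans e (sym (⊕-self x))))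

==v-refl : ∀ {r} (x : 𝔽₂^ r) → (x ==v x) ≡ true
==v-refl [] = refl
==v-refl (false ∷ x) = ==v-refl x
==v-refl (true ∷ x) = ==v-refl x

==v⇒≡ : ∀ {r} {x y : 𝔽₂^ r} → (x ==v y) ≡ true → x ≡ y
==v⇒≡ {x = []} {[]} e = refl
==v⇒≡ {x = false ∷ x} {false ∷ y} e = cong (false ∷_) (==v⇒≡ e)
==v⇒≡ {x = true ∷ x} {true ∷ y} e = cong (true ∷_) (==v⇒≡ e)

≢⇒==v-false : ∀ {r} {x y : 𝔽₂^ r} → x ≢ y → (x ==v y) ≡ false
≢⇒==v-false {x = x} {y} x≢y with x ==v y in eq
... | true = contradiction (==v⇒≡ eq) x≢y
... | false = refl

_≟v_ : ∀ {r} (x y : 𝔽₂^ r) → Dec (x ≡ y)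
x ≟v y with x ==v y in eq
... | true = yes (==v⇒≡ eq)
... | false = no λ { refl → contradiction (trans (sym (==v-refl x)) eq) λ () }

isNz-zeroV : ∀ r → isNz (zeroV r) ≡ false
isNz-zeroV zero = refl
isNz-zeroV (suc r) = isNz-zeroV r

isNz-false⇒zeroV : ∀ {r} (x : 𝔽₂^ r) → isNz x ≡ false → x ≡ zeroV r
isNz-false⇒zeroV [] e = refl
isNz-false⇒zeroV (false ∷ x) e = cong (false ∷_) (isNz-false⇒zeroV x e)

isNz⇒≢zeroV : ∀ {r} {x : 𝔽₂^ r} → isNz x ≡ true → x ≢ zeroV r
isNz⇒≢zeroV {r} e refl = contradiction (trans (sym e) (isNz-zeroV r)) λ ()

≢⇒isNz-⊕ : ∀ {r} {x y : 𝔽₂^ r} → x ≢ y → isNz (x ⊕ y) ≡ true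
≢⇒isNz-⊕ {x = x} {y} x≢y with isNz (x ⊕ y) in e
... | true = refl
... | false = contradiction (⊕≡zeroV⇒≡ x y (isNz-false⇒zeroV (x ⊕ y) e)) x≢y

dot-⊕ʳ : ∀ {r} (a x y : 𝔽₂^ r) → dot a (x ⊕ y) ≡ dot a x xor dot a y
dot-⊕ʳ [] [] [] = refl
dot-⊕ʳ (a ∷ as) (x ∷ xs) (y ∷ ys) = begin
  (a ∧ (x xor y)) xor dot as (xs ⊕ ys)
    ≡⟨ cong₂ _xor_ (∧-distribˡ-xor a x y) (dot-⊕ʳ as xs ys) ⟩
  ((a ∧ x) xor (a ∧ y)) xor (dot as xs xor dot as ys)
    ≡⟨ xor-interchange (a ∧ x) (a ∧ y) (dot as xs) (dot as ys) ⟩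
  ((a ∧ x) xor dot as xs) xor ((a ∧ y) xor dot as ys) ∎
  where open ≡-Reasoning

dot-zeroVʳ : ∀ {r} (a : 𝔽₂^ r) → dot a (zeroV r) ≡ false
dot-zeroVʳ [] = refl
dot-zeroVʳ (a ∷ as) rewrite dot-zeroVʳ as | ∧-zeroʳ a = refl

_·_ : ∀ {r} → Bool → 𝔽₂^ r → 𝔽₂^ r
_·_ {r} b x = if b then x else zeroV r

·-distribʳ-xor : ∀ {r} b c (x : 𝔽₂^ r) → (b xor c) · x ≡ (b · x) ⊕ (c · x)
·-distribʳ-xor false c x = sym (⊕-identityˡ _)
·-distribʳ-xor true false x = sym (⊕-identityʳ x)
·-distribʳ-xor true true x = sym (⊕-self x)

dot-· : ∀ {r} (a x : 𝔽₂^ r) → dot a x ≡ true → ∀ b → dot a (b · x) ≡ b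
dot-· a x e true = e
dot-· a x e false = dot-zeroVʳ a

module FiniteSum {A : Set} (_∙_ : A → A → A) (ε : A)
  (∙-assoc : Associative _≡_ _∙_) (∙-comm : Commutative _≡_ _∙_)
  (∙-identityˡ : LeftIdentity _≡_ ε _∙_) where

  ∑ : (k : ℕ) → (𝔽₂^ k → A) → A
  ∑ zero h = h []
  ∑ (suc k) h = ∑ k (h ∘ (false ∷_)) ∙ ∑ k (h ∘ (true ∷_))

  ∙-identityʳ : ∀ a → a ∙ ε ≡ a
  ∙-identityʳ a = trans (∙-comm a ε) (∙-identityˡ a)

  ∙-interchange : ∀ a b c d → (a ∙ b) ∙ (c ∙ d) ≡ (a ∙ c) ∙ (b ∙ d)
  ∙-interchange a b c d = begin
    (a ∙ b) ∙ (c ∙ d) ≡⟨ ∙-assoc a b (c ∙ d) ⟩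
    a ∙ (b ∙ (c ∙ d)) ≡⟨ cong (a ∙_) (∙-assoc b c d) ⟨
    a ∙ ((b ∙ c) ∙ d) ≡⟨ cong (λ z → a ∙ (z ∙ d)) (∙-comm b c) ⟩
    a ∙ ((c ∙ b) ∙ d) ≡⟨ cong (a ∙_) (∙-assoc c b d) ⟩
    a ∙ (c ∙ (b ∙ d)) ≡⟨ ∙-assoc a c (b ∙ d) ⟨
    (a ∙ c) ∙ (b ∙ d) ∎
    where open ≡-Reasoning

  foldr-allVecs : ∀ k (h : 𝔽₂^ k → A) → foldr (λ x → h x ∙_) ε (allVecs k) ≡ ∑ k h
  foldr-allVecs zero h = ∙-identityʳ (h [])
  foldr-allVecs (suc k) h = begin
    listSum h (map (false ∷_) vs ++ map (true ∷_) vs)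
      ≡⟨ listSum-++ h (map (false ∷_) vs) _ ⟩
    listSum h (map (false ∷_) vs) ∙ listSum h (map (true ∷_) vs)
      ≡⟨ cong₂ _∙_ (listSum-map h (false ∷_) vs) (listSum-map h (true ∷_) vs) ⟩
    listSum (h ∘ (false ∷_)) vs ∙ listSum (h ∘ (true ∷_)) vs
      ≡⟨ cong₂ _∙_ (foldr-allVecs k _) (foldr-allVecs k _) ⟩
    ∑ (suc k) h ∎
    where
    open ≡-Reasoning
    vs = allVecs k
    listSum : ∀ {B : Set} → (B → A) → List B → A
    listSum g = foldr (λ x → g x ∙_) ε
    listSum-++ : ∀ {B} (g : B → A) xs ys → listSum g (xs ++ ys) ≡ listSum g xs ∙ listSum g ys
    listSum-++ g [] ys = sym (∙-identityˡ _)
    listSum-++ g (x ∷ xs) ys = trans (cong (g x ∙_) (listSum-++ g xs ys)) (sym (∙-assoc _ _ _))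
    listSum-map : ∀ {B C : Set} (g : C → A) (f : B → C) xs → listSum g (map f xs) ≡ listSum (g ∘ f) xs
    listSum-map g f [] = refl
    listSum-map g f (x ∷ xs) = cong (g (f x) ∙_) (listSum-map g f xs)

  ∑-cong : ∀ k {h h′ : 𝔽₂^ k → A} → (∀ x → h x ≡ h′ x) → ∑ k h ≡ ∑ k h′
  ∑-cong zero e = e []
  ∑-cong (suc k) e = cong₂ _∙_ (∑-cong k (e ∘ (false ∷_))) (∑-cong k (e ∘ (true ∷_)))

  ∑-ε : ∀ k → ∑ k (λ _ → ε) ≡ ε
  ∑-ε zero = refl
  ∑-ε (suc k) = trans (cong₂ _∙_ (∑-ε k) (∑-ε k)) (∙-identityˡ ε)

  ∑-∙ : ∀ k (h h′ : 𝔽₂^ k → A) → ∑ k (λ x → h x ∙ h′ x) ≡ ∑ k h ∙ ∑ k h′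
  ∑-∙ zero h h′ = refl
  ∑-∙ (suc k) h h′ = trans (cong₂ _∙_ (∑-∙ k _ _) (∑-∙ k _ _)) (∙-interchange _ _ _ _)

  ∑-swap : ∀ m k (h : 𝔽₂^ m → 𝔽₂^ k → A) → ∑ m (λ u → ∑ k (h u)) ≡ ∑ k (λ x → ∑ m (λ u → h u x))
  ∑-swap zero k h = refl
  ∑-swap (suc m) k h = trans (cong₂ _∙_ (∑-swap m k _) (∑-swap m k _)) (sym (∑-∙ k _ _))

  ∑-point : ∀ k (z : 𝔽₂^ k) c → ∑ k (λ y → if z ==v y then c else ε) ≡ c
  ∑-point zero [] c = refl
  ∑-point (suc k) (false ∷ z) c = trans (cong₂ _∙_ (∑-point k z c) (∑-ε k)) (∙-identityʳ c)
  ∑-point (suc k) (true ∷ z) c = trans (cong₂ _∙_ (∑-ε k) (∑-point k z c)) (∙-identityˡ c)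

  ∑-reindex : ∀ {k r} (g : 𝔽₂^ k → 𝔽₂^ r) → Injective _≡_ _≡_ g → (h : 𝔽₂^ r → A)
    → (∀ y → (∃ λ x → g x ≡ y) ⊎ h y ≡ ε) → ∑ r h ≡ ∑ k (h ∘ g)
  ∑-reindex {k} {r} g g-inj h covered = begin
    ∑ r h                                                    ≡⟨ ∑-cong r fibre ⟨
    ∑ r (λ y → ∑ k (λ x → if g x ==v y then h y else ε))    ≡⟨ ∑-swap k r _ ⟨
    ∑ k (λ x → ∑ r (λ y → if g x ==v y then h y else ε))    ≡⟨ ∑-cong k point ⟩
    ∑ k (h ∘ g)                                              ∎
    where
    open ≡-Reasoning
    point : ∀ x → ∑ r (λ y → if g x ==v y then h y else ε) ≡ h (g x)
    point x = trans (∑-cong r λ y → at (g x ==v y) ==v⇒≡) (∑-point r (g x) (h (g x)))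
      where
      at : ∀ {y} b → (b ≡ true → g x ≡ y) → (if b then h y else ε) ≡ (if b then h (g x) else ε)
      at true gx≡y = cong h (sym (gx≡y refl))
      at false _ = refl
    fibre : ∀ y → ∑ k (λ x → if g x ==v y then h y else ε) ≡ h y
    fibre y with covered y
    ... | inj₂ hy≡ε = trans (∑-cong k λ x → at (g x ==v y)) (trans (∑-ε k) (sym hy≡ε))
      where
      at : ∀ b → (if b then h y else ε) ≡ ε
      at true = hy≡ε
      at false = refl
    ... | inj₁ (x₀ , gx₀≡y) = trans (∑-cong k λ x → cong (if_then h y else ε) (==v-fibre x)) (∑-point k x₀ (h y))
      where
      ==v-fibre : ∀ x → (g x ==v y) ≡ (x₀ ==v x)
      ==v-fibre x with x₀ ≟v x
      ... | yes refl rewrite gx₀≡y = trans (==v-refl y) (sym (==v-refl x₀))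
      ... | no x₀≢x = trans (≢⇒==v-false λ gx≡y → x₀≢x (g-inj (trans gx₀≡y (sym gx≡y)))) (sym (≢⇒==v-false x₀≢x))

  ∑-translate : ∀ k (h : 𝔽₂^ k → A) w → ∑ k (λ y → h (y ⊕ w)) ≡ ∑ k h
  ∑-translate zero h [] = refl
  ∑-translate (suc k) h (false ∷ w) = cong₂ _∙_ (∑-translate k _ w) (∑-translate k _ w)
  ∑-translate (suc k) h (true ∷ w) =
    trans (cong₂ _∙_ (∑-translate k (h ∘ (true ∷_)) w) (∑-translate k (h ∘ (false ∷_)) w)) (∙-comm _ _)

open FiniteSum _+_ 0 +-assoc +-comm +-identityˡ
module Σ⊕ (r : ℕ) = FiniteSum (_⊕_ {r}) (zeroV r) ⊕-assoc ⊕-comm ⊕-identityˡ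
module Σ∨ = FiniteSum _∨_ false ∨-assoc ∨-comm ∨-identityˡ

𝟙 : Bool → ℕ
𝟙 b = if b then 1 else 0

count≡∑ : ∀ r (S : VSet r) → count r S ≡ ∑ r (𝟙 ∘ S)
count≡∑ r S = trans (foldr-cong step refl (allVecs r)) (foldr-allVecs r (𝟙 ∘ S))
  where
  step : ∀ x n → (if S x then suc n else n) ≡ 𝟙 (S x) + n
  step x n with S x
  ... | true = refl
  ... | false = refl

vsum≡∑ : ∀ r (S : VSet r) → vsum r S ≡ Σ⊕.∑ r r (λ x → S x · x)
vsum≡∑ r S = trans (foldr-cong step refl (allVecs r)) (Σ⊕.foldr-allVecs r r (λ x → S x · x))
  where
  step : ∀ x v → (if S x then x ⊕ v else v) ≡ (S x · x) ⊕ v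
  step x v with S x
  ... | true = refl
  ... | false = sym (⊕-identityˡ v)

vsum-cong : ∀ r {S S′ : VSet r} → (∀ x → S x ≡ S′ x) → vsum r S ≡ vsum r S′
vsum-cong r {S} {S′} e = begin
  vsum r S                    ≡⟨ vsum≡∑ r S ⟩
  Σ⊕.∑ r r (λ x → S x · x)   ≡⟨ Σ⊕.∑-cong r r (λ x → cong (_· x) (e x)) ⟩
  Σ⊕.∑ r r (λ x → S′ x · x)  ≡⟨ vsum≡∑ r S′ ⟨
  vsum r S′                   ∎
  where open ≡-Reasoning

∑∨-true⇒∃ : ∀ k (h : 𝔽₂^ k → Bool) → Σ∨.∑ k h ≡ true → ∃ λ x → h x ≡ true
∑∨-true⇒∃ zero h e = [] , e
∑∨-true⇒∃ (suc k) h e with Σ∨.∑ k (h ∘ (false ∷_)) in e₀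
... | true = let x , hx = ∑∨-true⇒∃ k _ e₀ in false ∷ x , hx
... | false = let x , hx = ∑∨-true⇒∃ k _ e in true ∷ x , hx

∃⇒∑∨-true : ∀ k (h : 𝔽₂^ k → Bool) x → h x ≡ true → Σ∨.∑ k h ≡ true
∃⇒∑∨-true zero h [] e = e
∃⇒∑∨-true (suc k) h (false ∷ x) e rewrite ∃⇒∑∨-true k (h ∘ (false ∷_)) x e = refl
∃⇒∑∨-true (suc k) h (true ∷ x) e rewrite ∃⇒∑∨-true k (h ∘ (true ∷_)) x e = ∨-zeroʳ _

∃false⊎∀true : ∀ k (P : 𝔽₂^ k → Bool) → (∃ λ u → P u ≡ false) ⊎ (∀ u → P u ≡ true)
∃false⊎∀true zero P with P [] in e
... | false = inj₁ ([] , e)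
... | true = inj₂ λ { [] → e }
∃false⊎∀true (suc k) P with ∃false⊎∀true k (P ∘ (false ∷_)) | ∃false⊎∀true k (P ∘ (true ∷_))
... | inj₁ (u , e) | _ = inj₁ (false ∷ u , e)
... | inj₂ _ | inj₁ (u , e) = inj₁ (true ∷ u , e)
... | inj₂ all₀ | inj₂ all₁ = inj₂ λ { (false ∷ u) → all₀ u ; (true ∷ u) → all₁ u }

module _ {k r : ℕ} (g : 𝔽₂^ k → 𝔽₂^ r) (S : VSet k) where

  image-preimage : ∀ y → image g S y ≡ true → ∃ λ x → S x ≡ true × g x ≡ y
  image-preimage y e with ∑∨-true⇒∃ k _ (trans (sym (Σ∨.foldr-allVecs k _)) e)
  ... | x , Sx∧gx≡y = x , ∧-conicalˡ _ _ Sx∧gx≡y , ==v⇒≡ (∧-conicalʳ _ _ Sx∧gx≡y)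

  ∈image : ∀ x → S x ≡ true → image g S (g x) ≡ true
  ∈image x e = trans (Σ∨.foldr-allVecs k _)
    (∃⇒∑∨-true k _ x (cong₂ _∧_ e (==v-refl (g x))))

  image-injective : Injective _≡_ _≡_ g → ∀ x → image g S (g x) ≡ S x
  image-injective g-inj x with S x in eS
  ... | true = ∈image x eS
  ... | false with image g S (g x) in e
  ...   | false = refl
  ...   | true with image-preimage (g x) e
  ...     | x′ , Sx′ , gx′≡gx = contradiction (trans (sym Sx′) (trans (cong S (g-inj gx′≡gx)) eS)) λ ()

IsLinear : ∀ {k r} → (𝔽₂^ k → 𝔽₂^ r) → Set
IsLinear g = ∀ x y → g (x ⊕ y) ≡ g x ⊕ g y

module _ {k r : ℕ} {g : 𝔽₂^ k → 𝔽₂^ r} (g-lin : IsLinear g) where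

  linear-zeroV : g (zeroV k) ≡ zeroV r
  linear-zeroV = trans (cong g (sym (⊕-self (zeroV k)))) (trans (g-lin _ _) (⊕-self _))

  linear-· : ∀ b x → g (b · x) ≡ b · g x
  linear-· true x = refl
  linear-· false x = linear-zeroV

  linear-∑ : ∀ m (h : 𝔽₂^ m → 𝔽₂^ k) → g (Σ⊕.∑ k m h) ≡ Σ⊕.∑ r m (g ∘ h)
  linear-∑ zero h = refl
  linear-∑ (suc m) h = trans (g-lin _ _) (cong₂ _⊕_ (linear-∑ m _) (linear-∑ m _))

  module _ (g-inj : Injective _≡_ _≡_ g) where

    vsum-reindex : (T : VSet r) → (∀ y → T y ≡ true → ∃ λ x → g x ≡ y) → vsum r T ≡ g (vsum k (T ∘ g))
    vsum-reindex T T⊆range = begin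
      vsum r T                           ≡⟨ vsum≡∑ r T ⟩
      Σ⊕.∑ r r (λ y → T y · y)          ≡⟨ Σ⊕.∑-reindex r g g-inj _ covered ⟩
      Σ⊕.∑ r k (λ x → T (g x) · g x)    ≡⟨ Σ⊕.∑-cong r k (λ x → linear-· (T (g x)) x) ⟨
      Σ⊕.∑ r k (λ x → g (T (g x) · x))  ≡⟨ linear-∑ k _ ⟨
      g (Σ⊕.∑ k k (λ x → T (g x) · x))  ≡⟨ cong g (vsum≡∑ k (T ∘ g)) ⟨
      g (vsum k (T ∘ g))                 ∎
      where
      open ≡-Reasoning
      covered : ∀ y → (∃ λ x → g x ≡ y) ⊎ T y · y ≡ zeroV r
      covered y with T y in Ty
      ... | true = inj₁ (T⊆range y Ty)
      ... | false = inj₂ refl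

    Indep-image : (S : VSet k) → Indep k S ⇔ Indep r (image g S)
    Indep-image S = mk⇔ to from
      where
      to : Indep k S → Indep r (image g S)
      to S-indep T T⊆gS (t , Tt) vsumT≡0 with image-preimage g S t (T⊆gS t Tt)
      ... | x₀ , _ , refl = S-indep (T ∘ g) Tg⊆S (x₀ , Tt) (g-inj (begin
          g (vsum k (T ∘ g)) ≡⟨ vsum-reindex T T⊆range ⟨
          vsum r T           ≡⟨ vsumT≡0 ⟩
          zeroV r            ≡⟨ linear-zeroV ⟨
          g (zeroV k)        ∎))
        where
        open ≡-Reasoning
        T⊆range : ∀ y → T y ≡ true → ∃ λ x → g x ≡ y
        T⊆range y Ty = let x , _ , gx≡y = image-preimage g S y (T⊆gS y Ty) in x , gx≡y
        Tg⊆S : (T ∘ g) ⊆ S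
        Tg⊆S x Tgx = trans (sym (image-injective g S g-inj x)) (T⊆gS (g x) Tgx)
      from : Indep r (image g S) → Indep k S
      from gS-indep T T⊆S (t , Tt) vsumT≡0 = gS-indep (image g T) gT⊆gS (g t , ∈image g T t Tt) (begin
          vsum r (image g T)           ≡⟨ vsum-reindex (image g T) gT⊆range ⟩
          g (vsum k (image g T ∘ g))   ≡⟨ cong g (vsum-cong k (image-injective g T g-inj)) ⟩
          g (vsum k T)                 ≡⟨ cong g vsumT≡0 ⟩
          g (zeroV k)                  ≡⟨ linear-zeroV ⟩
          zeroV r                      ∎)
        where
        open ≡-Reasoning
        gT⊆range : ∀ y → image g T y ≡ true → ∃ λ x → g x ≡ y
        gT⊆range y gTy = let x , _ , gx≡y = image-preimage g T y gTy in x , gx≡y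
        gT⊆gS : image g T ⊆ image g S
        gT⊆gS y gTy with image-preimage g T y gTy
        ... | x , Tx , refl = ∈image g S x (T⊆S x Tx)

LinearEmbedding : (k r : ℕ) → VSet r → Set
LinearEmbedding k r E = Σ (𝔽₂^ k → 𝔽₂^ r) λ g →
  IsLinear g × Injective _≡_ _≡_ g × (∀ x → isNz x ≡ true → E (g x) ≡ true)

LinearEmbedding⇒HasPGRestriction : ∀ {k r} {E : VSet r} → LinearEmbedding k r E → HasPGRestriction k r E
LinearEmbedding⇒HasPGRestriction (g , g-lin , g-inj , gE) =
  g , gE , (λ _ _ _ _ → g-inj) , λ S _ → Indep-image g-lin g-inj S

Indep-⊆ : ∀ {r} {X Y : VSet r} → Y ⊆ X → Indep r X → Indep r Y
Indep-⊆ Y⊆X X-indep T T⊆Y = X-indep T (λ x Tx → Y⊆X x (T⊆Y x Tx))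

triple : ∀ {r} → 𝔽₂^ r → 𝔽₂^ r → 𝔽₂^ r → VSet r
triple p q s y = (p ==v y) ∨ ((q ==v y) ∨ (s ==v y))

module _ {r : ℕ} (p q s : 𝔽₂^ r) where

  triple-∋₁ : triple p q s p ≡ true
  triple-∋₁ rewrite ==v-refl p = refl

  triple-∋₂ : triple p q s q ≡ true
  triple-∋₂ rewrite ==v-refl q = ∨-zeroʳ (p ==v q)

  triple-∋₃ : triple p q s s ≡ true
  triple-∋₃ rewrite ==v-refl s | ∨-zeroʳ (q ==v s) = ∨-zeroʳ (p ==v s)

  triple-cases : ∀ y → triple p q s y ≡ true → y ≡ p ⊎ y ≡ q ⊎ y ≡ s
  triple-cases y e with p ==v y in p≡y | q ==v y in q≡y
  ... | true | _ = inj₁ (sym (==v⇒≡ p≡y))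
  ... | false | true = inj₂ (inj₁ (sym (==v⇒≡ q≡y)))
  ... | false | false = inj₂ (inj₂ (sym (==v⇒≡ e)))

  vsum-⊆triple : p ≢ q → p ≢ s → q ≢ s → (T : VSet r) → T ⊆ triple p q s
    → vsum r T ≡ (T p · p) ⊕ ((T q · q) ⊕ (T s · s))
  vsum-⊆triple p≢q p≢s q≢s T T⊆pqs = begin
    vsum r T                       ≡⟨ vsum≡∑ r T ⟩
    Σ⊕.∑ r r (λ y → T y · y)       ≡⟨ Σ⊕.∑-cong r r split ⟩
    Σ⊕.∑ r r (λ y → at p y ⊕ (at q y ⊕ at s y))
      ≡⟨ Σ⊕.∑-∙ r r _ _ ⟩
    Σ⊕.∑ r r (at p) ⊕ Σ⊕.∑ r r (λ y → at q y ⊕ at s y)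
      ≡⟨ cong (Σ⊕.∑ r r (at p) ⊕_) (Σ⊕.∑-∙ r r _ _) ⟩
    Σ⊕.∑ r r (at p) ⊕ (Σ⊕.∑ r r (at q) ⊕ Σ⊕.∑ r r (at s))
      ≡⟨ cong₂ _⊕_ (Σ⊕.∑-point r r p _) (cong₂ _⊕_ (Σ⊕.∑-point r r q _) (Σ⊕.∑-point r r s _)) ⟩
    (T p · p) ⊕ ((T q · q) ⊕ (T s · s)) ∎
    where
    open ≡-Reasoning
    at : 𝔽₂^ r → 𝔽₂^ r → 𝔽₂^ r
    at z y = if z ==v y then T z · z else zeroV r
    split : ∀ y → T y · y ≡ at p y ⊕ (at q y ⊕ at s y)
    split y with p ≟v y
    ... | yes refl rewrite ==v-refl p | ≢⇒==v-false (p≢q ∘ sym) | ≢⇒==v-false (p≢s ∘ sym) =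
          sym (trans (cong ((T p · p) ⊕_) (⊕-identityˡ _)) (⊕-identityʳ _))
    ... | no p≢y with q ≟v y
    ...   | yes refl rewrite ==v-refl q | ≢⇒==v-false p≢y | ≢⇒==v-false (q≢s ∘ sym) =
            sym (trans (⊕-identityˡ _) (⊕-identityʳ _))
    ...   | no q≢y with s ≟v y
    ...     | yes refl rewrite ==v-refl s | ≢⇒==v-false p≢y | ≢⇒==v-false q≢y =
              sym (trans (⊕-identityˡ _) (⊕-identityˡ _))
    ...     | no s≢y rewrite ≢⇒==v-false p≢y | ≢⇒==v-false q≢y | ≢⇒==v-false s≢y with T y in Ty
    ...       | false = sym (trans (⊕-identityˡ _) (⊕-identityˡ _))
    ...       | true = contradiction (trans (sym (T⊆pqs y Ty)) outside) λ ()
      where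
      outside : triple p q s y ≡ false
      outside rewrite ≢⇒==v-false p≢y | ≢⇒==v-false q≢y | ≢⇒==v-false s≢y = refl

≢-⊕ʳ : ∀ {r} (u : 𝔽₂^ r) {v} → isNz v ≡ true → u ≢ u ⊕ v
≢-⊕ʳ u nv u≡u⊕v = isNz⇒≢zeroV nv (sym (⊕-cancelˡ u _ _ (trans (⊕-identityʳ u) u≡u⊕v)))

line-dependent : ∀ {r} (u v : 𝔽₂^ r) → isNz u ≡ true → isNz v ≡ true → u ≢ v
  → ¬ Indep r (triple u v (u ⊕ v))
line-dependent {r} u v nu nv u≢v uvw-indep =
  uvw-indep (triple u v w) (λ _ e → e) (u , triple-∋₁ u v w) vsum≡zeroV
  where
  w = u ⊕ v
  v≢w : v ≢ w
  v≢w v≡w = ≢-⊕ʳ v nu (trans v≡w (⊕-comm u v))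
  vsum≡zeroV : vsum r (triple u v w) ≡ zeroV r
  vsum≡zeroV rewrite vsum-⊆triple u v w u≢v (≢-⊕ʳ u nv) v≢w _ (λ _ e → e)
                   | triple-∋₁ u v w | triple-∋₂ u v w | triple-∋₃ u v w =
    trans (sym (⊕-assoc u v w)) (⊕-self w)

triple-independent : ∀ {r} (p q s : 𝔽₂^ r) → isNz p ≡ true → isNz q ≡ true → isNz s ≡ true
  → p ≢ q → p ≢ s → q ≢ s → s ≢ p ⊕ q → Indep r (triple p q s)
triple-independent {r} p q s np nq ns p≢q p≢s q≢s s≢p⊕q T T⊆pqs (t , Tt) vsum≡zeroV =
  no-relation (T p) (T q) (T s) (trans (sym (vsum-⊆triple p q s p≢q p≢s q≢s T T⊆pqs)) vsum≡zeroV) nonempty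
  where
  Z = zeroV r
  nonempty : T p ≡ true ⊎ T q ≡ true ⊎ T s ≡ true
  nonempty with triple-cases p q s t (T⊆pqs t Tt)
  ... | inj₁ refl = inj₁ Tt
  ... | inj₂ (inj₁ refl) = inj₂ (inj₁ Tt)
  ... | inj₂ (inj₂ refl) = inj₂ (inj₂ Tt)
  no-relation : ∀ a b c → (a · p) ⊕ ((b · q) ⊕ (c · s)) ≡ Z → a ≡ true ⊎ b ≡ true ⊎ c ≡ true → ⊥
  no-relation false false false _ (inj₁ ())
  no-relation false false false _ (inj₂ (inj₁ ()))
  no-relation false false false _ (inj₂ (inj₂ ()))
  no-relation true false false e _ = isNz⇒≢zeroV np (trans (sym (trans (cong (p ⊕_) (⊕-identityˡ Z)) (⊕-identityʳ p))) e)
  no-relation false true false e _ = isNz⇒≢zeroV nq (trans (sym (trans (⊕-identityˡ _) (⊕-identityʳ q))) e)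
  no-relation false false true e _ = isNz⇒≢zeroV ns (trans (sym (trans (⊕-identityˡ _) (⊕-identityˡ s))) e)
  no-relation true true false e _ = p≢q (⊕≡zeroV⇒≡ p q (trans (cong (p ⊕_) (sym (⊕-identityʳ q))) e))
  no-relation true false true e _ = p≢s (⊕≡zeroV⇒≡ p s (trans (cong (p ⊕_) (sym (⊕-identityˡ s))) e))
  no-relation false true true e _ = q≢s (⊕≡zeroV⇒≡ q s (trans (sym (⊕-identityˡ _)) e))
  no-relation true true true e _ = s≢p⊕q (sym (⊕≡zeroV⇒≡ (p ⊕ q) s (trans (⊕-assoc p q s) e)))

zeroV⊎isNz : ∀ {r} (x : 𝔽₂^ r) → x ≡ zeroV r ⊎ isNz x ≡ true
zeroV⊎isNz x with isNz x in e
... | false = inj₁ (isNz-false⇒zeroV x e)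
... | true = inj₂ refl

-- f is only given on the points; it is extended by 0 ↦ 0 and is additive on lines because
-- {u, v, u ⊕ v} is dependent while three points of E not on a line are independent.
HasPGRestriction⇒LinearEmbedding : ∀ {k r} {E : VSet r} → IsRep r E → HasPGRestriction k r E
  → LinearEmbedding k r E
HasPGRestriction⇒LinearEmbedding {k} {r} {E} E-rep (f , fE , f-inj , f-indep) =
  F , F-linear , F-injective , λ u nu → subst (λ y → E y ≡ true) (sym (F-nz u nu)) (fE u nu)
  where
  F : 𝔽₂^ k → 𝔽₂^ r
  F u = if isNz u then f u else zeroV r

  F-nz : ∀ u → isNz u ≡ true → F u ≡ f u
  F-nz u nu rewrite nu = refl

  F-zeroV : F (zeroV k) ≡ zeroV r
  F-zeroV rewrite isNz-zeroV k = refl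

  isNz-f : ∀ u → isNz u ≡ true → isNz (f u) ≡ true
  isNz-f u nu = E-rep (f u) (fE u nu)

  f-additive : ∀ u v → isNz u ≡ true → isNz v ≡ true → u ≢ v → f (u ⊕ v) ≡ f u ⊕ f v
  f-additive u v nu nv u≢v with f (u ⊕ v) ≟v (f u ⊕ f v)
  ... | yes e = e
  ... | no fw≢fu⊕fv = ⊥-elim (line-dependent u v nu nv u≢v
         (Equivalence.from (f-indep (triple u v w) uvw-points) (Indep-⊆ f[uvw]⊆triple fuvw-indep)))
    where
    w = u ⊕ v
    nw = ≢⇒isNz-⊕ u≢v
    u≢w = ≢-⊕ʳ u nv
    v≢w : v ≢ w
    v≢w v≡w = ≢-⊕ʳ v nu (trans v≡w (⊕-comm u v))
    uvw-points : triple u v w ⊆ Points k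
    uvw-points x e with triple-cases u v w x e
    ... | inj₁ refl = nu
    ... | inj₂ (inj₁ refl) = nv
    ... | inj₂ (inj₂ refl) = nw
    f[uvw]⊆triple : image f (triple u v w) ⊆ triple (f u) (f v) (f w)
    f[uvw]⊆triple y e with image-preimage f (triple u v w) y e
    ... | x , x∈uvw , refl with triple-cases u v w x x∈uvw
    ...   | inj₁ refl = triple-∋₁ (f u) (f v) (f w)
    ...   | inj₂ (inj₁ refl) = triple-∋₂ (f u) (f v) (f w)
    ...   | inj₂ (inj₂ refl) = triple-∋₃ (f u) (f v) (f w)
    fuvw-indep : Indep r (triple (f u) (f v) (f w))
    fuvw-indep = triple-independent (f u) (f v) (f w) (isNz-f u nu) (isNz-f v nv) (isNz-f w nw)
      (u≢v ∘ f-inj u v nu nv) (u≢w ∘ f-inj u w nu nw) (v≢w ∘ f-inj v w nv nw) fw≢fu⊕fv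

  F-linear : IsLinear F
  F-linear u v with zeroV⊎isNz u | zeroV⊎isNz v
  ... | inj₁ refl | _ =
    trans (cong F (⊕-identityˡ v)) (sym (trans (cong (_⊕ F v) F-zeroV) (⊕-identityˡ (F v))))
  ... | inj₂ _ | inj₁ refl =
    trans (cong F (⊕-identityʳ u)) (sym (trans (cong (F u ⊕_) F-zeroV) (⊕-identityʳ (F u))))
  ... | inj₂ nu | inj₂ nv with u ≟v v
  ...   | yes refl = trans (cong F (⊕-self u)) (trans F-zeroV (sym (⊕-self (F u))))
  ...   | no u≢v = begin
    F (u ⊕ v)  ≡⟨ F-nz (u ⊕ v) (≢⇒isNz-⊕ u≢v) ⟩
    f (u ⊕ v)  ≡⟨ f-additive u v nu nv u≢v ⟩
    f u ⊕ f v  ≡⟨ cong₂ _⊕_ (F-nz u nu) (F-nz v nv) ⟨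
    F u ⊕ F v  ∎
    where open ≡-Reasoning

  F-injective : Injective _≡_ _≡_ F
  F-injective {u} {v} Fu≡Fv with zeroV⊎isNz u | zeroV⊎isNz v
  ... | inj₁ refl | inj₁ refl = refl
  ... | inj₁ refl | inj₂ nv =
    contradiction (trans (sym (F-nz v nv)) (trans (sym Fu≡Fv) F-zeroV)) (isNz⇒≢zeroV (isNz-f v nv))
  ... | inj₂ nu | inj₁ refl =
    contradiction (trans (sym (F-nz u nu)) (trans Fu≡Fv F-zeroV)) (isNz⇒≢zeroV (isNz-f u nu))
  ... | inj₂ nu | inj₂ nv = f-inj u v nu nv (trans (sym (F-nz u nu)) (trans Fu≡Fv (F-nz v nv)))

∑-mono-≤ : ∀ k {h h′ : 𝔽₂^ k → ℕ} → (∀ x → h x ≤ h′ x) → ∑ k h ≤ ∑ k h′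
∑-mono-≤ zero h≤h′ = h≤h′ []
∑-mono-≤ (suc k) h≤h′ = +-mono-≤ (∑-mono-≤ k (h≤h′ ∘ (false ∷_))) (∑-mono-≤ k (h≤h′ ∘ (true ∷_)))

∑-*ˡ : ∀ k c (h : 𝔽₂^ k → ℕ) → ∑ k (λ x → c * h x) ≡ c * ∑ k h
∑-*ˡ zero c h = refl
∑-*ˡ (suc k) c h = trans (cong₂ _+_ (∑-*ˡ k c _) (∑-*ˡ k c _)) (sym (*-distribˡ-+ c _ _))

∑-const : ∀ k c → ∑ k (λ _ → c) ≡ 2 ^ k * c
∑-const zero c = sym (+-identityʳ c)
∑-const (suc k) c rewrite ∑-const k c | *-assoc 2 (2 ^ k) c | +-identityʳ (2 ^ k * c) = refl

∑𝟙-missing : ∀ k (P : 𝔽₂^ k → Bool) u₀ → P u₀ ≡ false → ∑ k (𝟙 ∘ P) + 1 ≤ 2 ^ k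
∑𝟙-missing k P u₀ Pu₀ = begin
  ∑ k (𝟙 ∘ P) + 1                                ≡⟨ cong (∑ k (𝟙 ∘ P) +_) (∑-point k u₀ 1) ⟨
  ∑ k (𝟙 ∘ P) + ∑ k (λ u → 𝟙 (u₀ ==v u))         ≡⟨ ∑-∙ k _ _ ⟨
  ∑ k (λ u → 𝟙 (P u) + 𝟙 (u₀ ==v u))             ≤⟨ ∑-mono-≤ k at-most-one ⟩
  ∑ k (λ _ → 1)                                  ≡⟨ ∑-const k 1 ⟩
  2 ^ k * 1                                      ≡⟨ *-identityʳ _ ⟩
  2 ^ k                                          ∎
  where
  open ≤-Reasoning
  at-most-one : ∀ u → 𝟙 (P u) + 𝟙 (u₀ ==v u) ≤ 1
  at-most-one u with u₀ ≟v u
  ... | yes refl rewrite Pu₀ | ==v-refl u₀ = ≤-refl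
  ... | no u₀≢u rewrite ≢⇒==v-false u₀≢u with P u
  ...   | true = ≤-refl
  ...   | false = z≤n

-- Double counting the pairs (x , u) with x ∈ D and x ⊕ F u ∈ E.
translate-count-bound : ∀ {m r} (F : 𝔽₂^ m → 𝔽₂^ r) (D E : VSet r)
  → (∀ x u → D (x ⊕ F u) ≡ D x)
  → (∀ x → D x ≡ true → ∃ λ u → E (x ⊕ F u) ≡ false)
  → 2 ^ m * ∑ r (λ x → 𝟙 (E x ∧ D x)) + ∑ r (𝟙 ∘ D) ≤ 2 ^ m * ∑ r (𝟙 ∘ D)
translate-count-bound {m} {r} F D E D-invariant D-escapes = begin
  2 ^ m * C + ∑ r (𝟙 ∘ D)                                   ≡⟨ cong (_+ ∑ r (𝟙 ∘ D)) average ⟩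
  ∑ m (λ u → ∑ r (K u)) + ∑ r (𝟙 ∘ D)                       ≡⟨ cong (_+ ∑ r (𝟙 ∘ D)) (∑-swap m r K) ⟩
  ∑ r (λ x → ∑ m (λ u → K u x)) + ∑ r (𝟙 ∘ D)               ≡⟨ ∑-∙ r _ _ ⟨
  ∑ r (λ x → ∑ m (λ u → K u x) + 𝟙 (D x))                   ≤⟨ ∑-mono-≤ r pointwise ⟩
  ∑ r (λ x → 2 ^ m * 𝟙 (D x))                               ≡⟨ ∑-*ˡ r (2 ^ m) (𝟙 ∘ D) ⟩
  2 ^ m * ∑ r (𝟙 ∘ D)                                       ∎
  where
  open ≤-Reasoning
  C = ∑ r (λ x → 𝟙 (E x ∧ D x))
  K : 𝔽₂^ m → 𝔽₂^ r → ℕ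
  K u x = 𝟙 (E (x ⊕ F u) ∧ D x)
  average : 2 ^ m * C ≡ ∑ m (λ u → ∑ r (K u))
  average = sym (trans (∑-cong m translate) (∑-const m C))
    where
    translate : ∀ u → ∑ r (K u) ≡ C
    translate u = trans (∑-cong r λ x → cong (λ b → 𝟙 (E (x ⊕ F u) ∧ b)) (sym (D-invariant x u)))
                        (∑-translate r (λ y → 𝟙 (E y ∧ D y)) (F u))
  pointwise : ∀ x → ∑ m (λ u → K u x) + 𝟙 (D x) ≤ 2 ^ m * 𝟙 (D x)
  pointwise x with D x in Dx
  ... | false rewrite ∑-cong m (λ u → cong 𝟙 (∧-zeroʳ (E (x ⊕ F u)))) | ∑-ε m | *-zeroʳ (2 ^ m) = z≤n
  ... | true rewrite ∑-cong m (λ u → cong 𝟙 (∧-identityʳ (E (x ⊕ F u)))) | *-identityʳ (2 ^ m) =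
    let u₀ , Eu₀ = D-escapes x Dx in ∑𝟙-missing m (λ u → E (x ⊕ F u)) u₀ Eu₀

-- The functional a separates x from the image of F, so b ∷ u ↦ b·x ⊕ F u is injective.
LinearEmbedding-extend : ∀ {m r} {E : VSet r} (a x : 𝔽₂^ r) (F : 𝔽₂^ m → 𝔽₂^ r)
  → IsLinear F → Injective _≡_ _≡_ F → (∀ u → isNz u ≡ true → E (F u) ≡ true)
  → (∀ u → dot a (F u) ≡ false) → dot a x ≡ true → (∀ u → E (x ⊕ F u) ≡ true)
  → LinearEmbedding (suc m) r E
LinearEmbedding-extend {m} {r} {E} a x F F-lin F-inj FE aF≡0 ax≡1 x+F⊆E = g , g-lin , g-inj , gE
  where
  g : 𝔽₂^ (suc m) → 𝔽₂^ r
  g (b ∷ u) = (b · x) ⊕ F u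

  g-lin : IsLinear g
  g-lin (b ∷ u) (c ∷ v) =
    trans (cong₂ _⊕_ (·-distribʳ-xor b c x) (F-lin u v)) (Σ⊕.∙-interchange r _ _ _ _)

  dot-g : ∀ b u → dot a (g (b ∷ u)) ≡ b
  dot-g b u = begin
    dot a ((b · x) ⊕ F u)            ≡⟨ dot-⊕ʳ a (b · x) (F u) ⟩
    dot a (b · x) xor dot a (F u)    ≡⟨ cong₂ _xor_ (dot-· a x ax≡1 b) (aF≡0 u) ⟩
    b xor false                      ≡⟨ xor-identityʳ b ⟩
    b                                ∎
    where open ≡-Reasoning

  g-inj : Injective _≡_ _≡_ g
  g-inj {b ∷ u} {c ∷ v} gbu≡gcv with trans (sym (dot-g b u)) (trans (cong (dot a) gbu≡gcv) (dot-g c v))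
  ... | refl = cong (b ∷_) (F-inj (⊕-cancelˡ (b · x) (F u) (F v) gbu≡gcv))

  gE : ∀ y → isNz y ≡ true → E (g y) ≡ true
  gE (true ∷ u) _ = x+F⊆E u
  gE (false ∷ u) nu = subst (λ y → E y ≡ true) (sym (⊕-identityˡ (F u))) (FE u nu)

∑𝟙-dot : ∀ r (a : 𝔽₂^ (suc r)) → isNz a ≡ true → ∑ (suc r) (𝟙 ∘ dot a) ≡ 2 ^ r
∑𝟙-dot r (true ∷ a) _ = begin
  ∑ r (𝟙 ∘ dot a) + ∑ r (λ v → 𝟙 (not (dot a v)))  ≡⟨ ∑-∙ r _ _ ⟨
  ∑ r (λ v → 𝟙 (dot a v) + 𝟙 (not (dot a v)))      ≡⟨ ∑-cong r (λ v → 𝟙+𝟙-not (dot a v)) ⟩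
  ∑ r (λ _ → 1)                                    ≡⟨ ∑-const r 1 ⟩
  2 ^ r * 1                                        ≡⟨ *-identityʳ _ ⟩
  2 ^ r                                            ∎
  where
  open ≡-Reasoning
  𝟙+𝟙-not : ∀ b → 𝟙 b + 𝟙 (not b) ≡ 1
  𝟙+𝟙-not true = refl
  𝟙+𝟙-not false = refl
∑𝟙-dot zero (false ∷ []) ()
∑𝟙-dot (suc r) (false ∷ a) na rewrite ∑𝟙-dot r a na | +-identityʳ (2 ^ r) = refl

count-∖hyperplane : ∀ r (E : VSet r) (a : 𝔽₂^ r) → IsRep r E
  → count r (E ∖ hyperplane r a) ≡ ∑ r (λ x → 𝟙 (E x ∧ dot a x))
count-∖hyperplane r E a E-rep = trans (count≡∑ r _) (∑-cong r λ x → cong 𝟙 (at x))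
  where
  at : ∀ x → (E ∖ hyperplane r a) x ≡ E x ∧ dot a x
  at x with E x in Ex
  ... | false = refl
  ... | true rewrite E-rep x Ex = not-involutive (dot a x)

count-∩+∖ : ∀ r (E H : VSet r) → count r E ≡ count r (E ∩ H) + count r (E ∖ H)
count-∩+∖ r E H = begin
  count r E                                              ≡⟨ count≡∑ r E ⟩
  ∑ r (𝟙 ∘ E)                                            ≡⟨ ∑-cong r at ⟩
  ∑ r (λ x → 𝟙 ((E ∩ H) x) + 𝟙 ((E ∖ H) x))              ≡⟨ ∑-∙ r _ _ ⟩
  ∑ r (𝟙 ∘ (E ∩ H)) + ∑ r (𝟙 ∘ (E ∖ H))                  ≡⟨ cong₂ _+_ (count≡∑ r _) (count≡∑ r _) ⟨
  count r (E ∩ H) + count r (E ∖ H)                      ∎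
  where
  open ≡-Reasoning
  at : ∀ x → 𝟙 (E x) ≡ 𝟙 ((E ∩ H) x) + 𝟙 ((E ∖ H) x)
  at x with E x | H x
  ... | true | true = refl
  ... | true | false = refl
  ... | false | _ = refl

hyperplane-complement-bound : ∀ m r (E : VSet (suc r)) → IsRep (suc r) E → PGFree (suc m) (suc r) E
  → (a : 𝔽₂^ (suc r)) → isNz a ≡ true → HasPGRestriction m (suc r) (E ∩ hyperplane (suc r) a)
  → 2 ^ m * count (suc r) (E ∖ hyperplane (suc r) a) + 2 ^ r ≤ 2 ^ m * 2 ^ r
hyperplane-complement-bound m r E E-rep E-free a na E∩H-restriction
  with HasPGRestriction⇒LinearEmbedding {E = E ∩ hyperplane (suc r) a}
         (λ x e → E-rep x (∧-conicalˡ (E x) _ e)) E∩H-restriction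
... | F , F-lin , F-inj , FE∩H = begin
  2 ^ m * count (suc r) (E ∖ hyperplane (suc r) a) + 2 ^ r
    ≡⟨ cong₂ (λ c d → 2 ^ m * c + d) (count-∖hyperplane (suc r) E a E-rep) (sym (∑𝟙-dot r a na)) ⟩
  2 ^ m * ∑ (suc r) (λ x → 𝟙 (E x ∧ dot a x)) + ∑ (suc r) (𝟙 ∘ dot a)
    ≤⟨ translate-count-bound F (dot a) E dot-invariant escapes ⟩
  2 ^ m * ∑ (suc r) (𝟙 ∘ dot a)
    ≡⟨ cong (2 ^ m *_) (∑𝟙-dot r a na) ⟩
  2 ^ m * 2 ^ r ∎
  where
  open ≤-Reasoning
  FE : ∀ u → isNz u ≡ true → E (F u) ≡ true
  FE u nu = ∧-conicalˡ (E (F u)) _ (FE∩H u nu)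
  aF≡0 : ∀ u → dot a (F u) ≡ false
  aF≡0 u with zeroV⊎isNz u
  ... | inj₁ refl = trans (cong (dot a) (linear-zeroV F-lin)) (dot-zeroVʳ a)
  ... | inj₂ nu = trans (sym (not-involutive _)) (cong not (∧-conicalʳ (isNz (F u)) _ (∧-conicalʳ (E (F u)) _ (FE∩H u nu))))
  dot-invariant : ∀ x u → dot a (x ⊕ F u) ≡ dot a x
  dot-invariant x u = trans (dot-⊕ʳ a x (F u)) (trans (cong (dot a x xor_) (aF≡0 u)) (xor-identityʳ _))
  escapes : ∀ x → dot a x ≡ true → ∃ λ u → E (x ⊕ F u) ≡ false
  escapes x ax≡1 with ∃false⊎∀true m (λ u → E (x ⊕ F u))
  ... | inj₁ u,Eu≡0 = u,Eu≡0
  ... | inj₂ x+F⊆E = ⊥-elim (E-free (LinearEmbedding⇒HasPGRestriction {E = E}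
                        (LinearEmbedding-extend {E = E} a x F F-lin F-inj FE aF≡0 ax≡1 x+F⊆E)))

cancel-2^m : ∀ m r c → m ≤ r → 2 ^ m * c + 2 ^ r ≤ 2 ^ m * 2 ^ r → c + 2 ^ (r ∸ m) ≤ 2 ^ r
cancel-2^m m r c m≤r h = *-cancelˡ-≤ (2 ^ m) {{m^n≢0 2 m}} (begin
  2 ^ m * (c + 2 ^ (r ∸ m))           ≡⟨ *-distribˡ-+ (2 ^ m) c _ ⟩
  2 ^ m * c + 2 ^ m * 2 ^ (r ∸ m)     ≡⟨ cong (2 ^ m * c +_) 2^r≡2^m*2^[r∸m] ⟨
  2 ^ m * c + 2 ^ r                   ≤⟨ h ⟩
  2 ^ m * 2 ^ r                       ∎)
  where
  open ≤-Reasoning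
  2^r≡2^m*2^[r∸m] : 2 ^ r ≡ 2 ^ m * 2 ^ (r ∸ m)
  2^r≡2^m*2^[r∸m] = trans (cong (2 ^_) (sym (m+[n∸m]≡n m≤r))) (^-distribˡ-+-* 2 m (r ∸ m))

complement⇒intersection-bound : ∀ R x y d → y + d ≤ R → 2 * R < (x + y) + 3 * d → R < x + 2 * d
complement⇒intersection-bound R x y d y+d≤R 2R<x+y+3d = +-cancelˡ-≤ R (suc R) (x + 2 * d) (begin
  R + suc R              ≡⟨ solve 1 (λ R → R :+ (con 1 :+ R) := con 1 :+ con 2 :* R) refl R ⟩
  suc (2 * R)            ≤⟨ 2R<x+y+3d ⟩
  (x + y) + 3 * d        ≡⟨ solve 3 (λ x y d → (x :+ y) :+ con 3 :* d := (y :+ d) :+ (x :+ con 2 :* d)) refl x y d ⟩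
  (y + d) + (x + 2 * d)  ≤⟨ +-monoˡ-≤ (x + 2 * d) y+d≤R ⟩
  R + (x + 2 * d)        ∎)
  where
  open ≤-Reasoning
  open +-*-Solver

lemma2p3 : (r n : ℕ) → 3 ≤ n → n ≤ r
    → (E : VSet r) → IsRep r E → PGFree n r E
    → (a : 𝔽₂^ r) → isNz a ≡ true
    → ¬ PGFree (n ∸ 1) r (E ∩ hyperplane r a)
    → (count r (E ∖ hyperplane r a) + 2 ^ (r ∸ n) ≤ 2 ^ (r ∸ 1))
      × (2 ^ r < count r E + 3 * 2 ^ (r ∸ n)
         → 2 ^ (r ∸ 1) < count r (E ∩ hyperplane r a) + 2 * 2 ^ (r ∸ n))
lemma2p3 (suc r) (suc m) _ (s≤s m≤r) E E-rep E-free a na E∩H-notFree = complement-bound , intersection-bound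
  where
  H = hyperplane (suc r) a
  complement-bound : count (suc r) (E ∖ H) + 2 ^ (r ∸ m) ≤ 2 ^ r
  -- The hypothesis on E ∩ H is only a double negation; the goal is decidable, so it suffices.
  complement-bound = decidable-stable (_ ≤? _) λ ¬bound → E∩H-notFree λ E∩H-restriction →
    ¬bound (cancel-2^m m r _ m≤r (hyperplane-complement-bound m r E E-rep E-free a na E∩H-restriction))
  intersection-bound : 2 ^ suc r < count (suc r) E + 3 * 2 ^ (r ∸ m) → 2 ^ r < count (suc r) (E ∩ H) + 2 * 2 ^ (r ∸ m)
  intersection-bound large =
    complement⇒intersection-bound (2 ^ r) (count (suc r) (E ∩ H)) (count (suc r) (E ∖ H)) (2 ^ (r ∸ m)) complement-bound
    (subst (λ c → 2 ^ suc r < c + 3 * 2 ^ (r ∸ m)) (count-∩+∖ (suc r) E H) large)
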